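{- Let $f_1,\dots,f_m\in\mathbb{Z}[x_1,\dots,x_d]$. There exists $\mathbf{n}\in\mathbb{R}^d$ such that $\{f_i\}_{i\in\{1,\dots,m\}}$ has a positive vertex cluster with respect to $\mathbf{n}$ if and only if the formula $\bigwedge_{i=1}^m\psi(f_i,\mathbf{n},c_i)$ is satisfiable, i.e., there exist $\mathbf{n}\in\mathbb{R}^d$ and $c_1,\dots,c_m\in\mathbb{R}$ making it true, where $$\psi(f,\mathbf{n},c)\;=\;\Big[\bigvee_{\mathbf{p}\in\operatorname{frame}^+(f)}\mathbf{n}^T\mathbf{p}+c>0\Big]\wedge\Big[\bigwedge_{\mathbf{q}\in\operatorname{frame}^-(f)}\mathbf{n}^T\mathbf{q}+c<0\Big].$$
   Context: For $f=\sum_{\mathbf{p}\in F}f_\mathbf{p}\mathbf{x}^\mathbf{p}$ with $f_\mathbf{p}\neq0$ and $F\subset\mathbb{N}^d$ finite, $\operatorname{frame}(f)=F$, $\operatorname{frame}^+(f)=\{\mathbf{p}\in F\mid f_\mathbf{p}>0\}$, $\operatorname{frame}^-(f)=\{\mathbf{p}\in F\mid f_\mathbf{p}<0\}$. An empty disjunction is false and an empty conjunction is true. A point $\mathbf{p}$ is a vertex of $\operatorname{conv}(S)$ with respect to $\mathbf{n}$ if $\mathbf{n}^T\mathbf{p}>\mathbf{n}^T\mathbf{q}$ for all $\mathbf{q}\in\operatorname{conv}(S)\setminus\{\mathbf{p}\}$. A tuple $(\mathbf{p}_1,\dots,\mathbf{p}_m)$ is a positive vertex cluster of $\{f_i\}_i$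 with respect to $\mathbf{n}$ if for every $i$, $\mathbf{p}_i\in\operatorname{frame}^+(f_i)$ and $\mathbf{p}_i$ is a vertex of $\operatorname{conv}(\operatorname{frame}(f_i))$ with respect to $\mathbf{n}$.
   Formalization: The vector $\mathbf{n}$ and the constants $c_1,\dots,c_m$ are taken in ℚ^d and ℚ instead of ℝ, and $\operatorname{conv}(S)$ is formed from convex combinations with rational weights. -}

module Defs where

open import Data.Nat using (ℕ)
open import Data.Integer as ℤ using (ℤ; +_)
open import Data.Rational as ℚ using (ℚ; 0ℚ; 1ℚ; _/_)
open import Data.Fin using (Fin)
open import Data.Vec using (Vec; foldr; zipWith; replicate; fromList; lookup)
import Data.Vec as Vec
open import Data.List using (List; map; length)
open import Data.List.Membership.Propositional using (_∈_)
open import Data.List.Relation.Unary.All using (All)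
open import Data.List.Relation.Unary.Unique.Propositional using (Unique)
open import Data.Product using (Σ; ∃; _×_; _,_; proj₁; proj₂)
open import Relation.Binary.PropositionalEquality using (_≡_; _≢_)

Exponent : ℕ → Set
Exponent d = Vec ℕ d

Point : ℕ → Set
Point d = Vec ℚ d

-- A polynomial f ∈ ℤ[x₁,…,x_d], written f = Σ_{p ∈ F} f_p x^p with
-- f_p ≠ 0 and F finite: a list of (exponent, coefficient) terms with
-- nonzero coefficients and pairwise distinct exponents.
record Poly (d : ℕ) : Set where
  field
    terms    : List (Exponent d × ℤ)
    nonzero  : All (λ t → proj₂ t ≢ + 0) terms
    distinct : Unique (map proj₁ terms)
open Poly public

frame : ∀ {d} → Poly d → List (Exponent d)
frame f = map proj₁ (terms f)

_∈frame⁺_ : ∀ {d} → Exponent d → Poly d → Set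
p ∈frame⁺ f = ∃ λ c → ((p , c) ∈ terms f) × (+ 0 ℤ.< c)

_∈frame⁻_ : ∀ {d} → Exponent d → Poly d → Set
q ∈frame⁻ f = ∃ λ c → ((q , c) ∈ terms f) × (c ℤ.< + 0)

embed : ∀ {d} → Exponent d → Point d
embed = Vec.map (λ k → (+ k) / 1)

_·_ : ∀ {d} → Point d → Point d → ℚ
n · x = foldr _ ℚ._+_ 0ℚ (zipWith ℚ._*_ n x)

_⊕_ : ∀ {d} → Point d → Point d → Point d
_⊕_ = zipWith ℚ._+_

_⊙_ : ∀ {d} → ℚ → Point d → Point d
a ⊙ x = Vec.map (a ℚ.*_) x

linComb : ∀ {d k} → Vec ℚ k → Vec (Point d) k → Point d
linComb {d} w s = foldr _ _⊕_ (replicate d 0ℚ) (zipWith _⊙_ w s)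

sumℚ : ∀ {k} → Vec ℚ k → ℚ
sumℚ = foldr _ ℚ._+_ 0ℚ

InConv : ∀ {d} → List (Point d) → Point d → Set
InConv S x =
  Σ (Vec ℚ (length S)) λ w →
    ((j : Fin (length S)) → 0ℚ ℚ.≤ lookup w j) ×
    (sumℚ w ≡ 1ℚ) ×
    (x ≡ linComb w (fromList S))

IsVertexWrt : ∀ {d} → Point d → List (Point d) → Point d → Set
IsVertexWrt n S p = ∀ q → InConv S q → q ≢ p → n · q ℚ.< n · p

IsPositiveVertexCluster : ∀ {d m} → (Fin m → Poly d) → Point d → (Fin m → Exponent d) → Set
IsPositiveVertexCluster fs n ps =
  ∀ i → (ps i ∈frame⁺ fs i) ×
        IsVertexWrt n (map embed (frame (fs i))) (embed (ps i))

HasPositiveVertexCluster : ∀ {d m} → (Fin m → Poly d) → Point d → Set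
HasPositiveVertexCluster fs n = ∃ λ ps → IsPositiveVertexCluster fs n ps

ψ : ∀ {d} → Poly d → Point d → ℚ → Set
ψ f n c =
  (∃ λ p → (p ∈frame⁺ f) × (0ℚ ℚ.< n · embed p ℚ.+ c)) ×
  (∀ q → q ∈frame⁻ f → n · embed q ℚ.+ c ℚ.< 0ℚ)

{-# OPTIONS --safe #-}
-- If p is a positive vertex of frame(f) with respect to n, every exponent q with negative
-- coefficient satisfies nᵀq < nᵀp, so c can be chosen with -c strictly between the largest
-- such nᵀq and nᵀp.
--
-- Conversely, given n and the cᵢ, perturb n to n′ = n + ε e with e = (1, B, B², …), B larger
-- than every coordinate of every exponent. For small ε > 0, n′ keeps each strict inequality
-- nᵀs < nᵀt between exponents, and s ↦ n′ᵀs is injective on them: ties of n are broken by e,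
-- and eᵀs reads s as a base-B number. The n′-maximiser p of frame(fᵢ) is then a strict
-- maximiser, hence a vertex of the hull, and its coefficient is positive: if it were negative,
-- nᵀp + cᵢ < 0 < nᵀp⁺ + cᵢ for the positive exponent p⁺ given by ψ, so n′ᵀp < n′ᵀp⁺.
module Submission where

open import Defs
open import Data.Nat as ℕ using (ℕ; zero; suc)
open import Data.Integer as ℤ using (ℤ)
open import Data.Rational as ℚ using (ℚ; mkℚ; 0ℚ; 1ℚ; _/_; ↥_; _+_; _*_; _-_; -_; _⊓_; 1/_; _<_; _≤_)
import Data.Rational.Properties as ℚP
import Data.Integer.Properties as ℤP
import Data.Nat.Properties as ℕP
open import Data.Nat.DivMod using (_%_; [m+kn]%n≡m%n; m<n⇒m%n≡m)
open import Data.Nat.ListAction using (sum)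
import Data.Nat.Coprimality as Coprimality
open import Relation.Binary.Bundles using (DecTotalOrder)
open import Data.List.Extrema (DecTotalOrder.totalOrder ℚP.≤-decTotalOrder)
  using (max; xs≤max; argmax; argmax-all; f[xs]≤f[argmax])
open import Data.Rational.Solver using (module +-*-Solver)
open import Data.Fin using (Fin; zero; suc)
open import Data.Vec as Vec using (Vec; []; _∷_; replicate; fromList; lookup)
import Data.Vec.Properties as VecP
open import Data.Vec.Relation.Unary.All as VecAll using ([]; _∷_) renaming (All to VecAll)
open import Data.List as List using (List; []; _∷_; map; length; concatMap; allFin)
open import Data.List.Membership.Propositional using (_∈_; lose)
open import Data.List.Relation.Binary.Subset.Propositional using (_⊆_)
open import Data.List.Membership.Propositional.Properties
  using (∈-map⁺; ∈-map⁻; ∈-filter⁺; ∈-filter⁻; ∈-cartesianProductWith⁺; ∈-concatMap⁺; ∈-allFin)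
open import Data.List.Relation.Unary.Any using (here; there)
open import Data.List.Relation.Unary.All as All using (All)
open import Data.List.Relation.Unary.AllPairs using (_∷_)
open import Data.List.Relation.Unary.Unique.Propositional using (Unique)
open import Function using (id; _∘_; case_of_)
open import Function.Bundles using (_⇔_; mk⇔)
open import Data.Product using (Σ; ∃; _×_; _,_; proj₁; proj₂)
open import Data.Sum using (_⊎_; inj₁; inj₂; [_,_]′)
open import Data.Empty using (⊥-elim)
open import Relation.Nullary using (¬_; yes; no; contradiction)
open import Relation.Binary using (tri<; tri≈; tri>)
open import Relation.Binary.PropositionalEquality

open +-*-Solver

<⇒≱ : ∀ {p q} → p < q → ¬ q ≤ p
<⇒≱ p<q q≤p = ℚP.<-irrefl refl (ℚP.<-≤-trans p<q q≤p)

+-cancelʳ-< : ∀ {p q} r → p + r < q + r → p < q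
+-cancelʳ-< r p+r<q+r = ℚP.≰⇒> λ q≤p → <⇒≱ p+r<q+r (ℚP.+-monoˡ-≤ r q≤p)

p<q⇒p-q<0 : ∀ {p q} → p < q → p - q < 0ℚ
p<q⇒p-q<0 {p} {q} p<q = subst (p - q <_) (ℚP.+-inverseʳ q) (ℚP.+-monoˡ-< (- q) p<q)

p<q⇒0<q-p : ∀ {p q} → p < q → 0ℚ < q - p
p<q⇒0<q-p {p} {q} p<q = subst (_< q - p) (ℚP.+-inverseʳ p) (ℚP.+-monoˡ-< (- p) p<q)

p-1<p : ∀ p → p - 1ℚ < p
p-1<p p = subst (p - 1ℚ <_) (ℚP.+-identityʳ p) (ℚP.+-monoʳ-< p (ℚP.negative⁻¹ (- 1ℚ)))

·-distribˡ-⊕ : ∀ {d} (n a b : Point d) → n · (a ⊕ b) ≡ n · a + n · b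
·-distribˡ-⊕ [] [] [] = refl
·-distribˡ-⊕ (x ∷ n) (y ∷ a) (z ∷ b) rewrite ·-distribˡ-⊕ n a b =
  solve 5 (λ x y z u v → x :* (y :+ z) :+ (u :+ v) := (x :* y :+ u) :+ (x :* z :+ v))
    refl x y z (n · a) (n · b)

·-distribʳ-⊕ : ∀ {d} (n m a : Point d) → (n ⊕ m) · a ≡ n · a + m · a
·-distribʳ-⊕ [] [] [] = refl
·-distribʳ-⊕ (x ∷ n) (y ∷ m) (z ∷ a) rewrite ·-distribʳ-⊕ n m a =
  solve 5 (λ x y z u v → (x :+ y) :* z :+ (u :+ v) := (x :* z :+ u) :+ (y :* z :+ v))
    refl x y z (n · a) (m · a)

·-⊙ˡ : ∀ {d} c (n a : Point d) → (c ⊙ n) · a ≡ c * (n · a)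
·-⊙ˡ c [] [] = sym (ℚP.*-zeroʳ c)
·-⊙ˡ c (x ∷ n) (y ∷ a) rewrite ·-⊙ˡ c n a =
  solve 4 (λ c x y u → (c :* x) :* y :+ c :* u := c :* (x :* y :+ u)) refl c x y (n · a)

·-⊙ʳ : ∀ {d} c (n a : Point d) → n · (c ⊙ a) ≡ c * (n · a)
·-⊙ʳ c [] [] = sym (ℚP.*-zeroʳ c)
·-⊙ʳ c (x ∷ n) (y ∷ a) rewrite ·-⊙ʳ c n a =
  solve 4 (λ c x y u → x :* (c :* y) :+ c :* u := c :* (x :* y :+ u)) refl c x y (n · a)

⊙-zeroˡ : ∀ {d} (v : Point d) → 0ℚ ⊙ v ≡ replicate d 0ℚ
⊙-zeroˡ [] = refl
⊙-zeroˡ (x ∷ v) = cong₂ _∷_ (ℚP.*-zeroˡ x) (⊙-zeroˡ v)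

⊙-identityˡ : ∀ {d} (v : Point d) → 1ℚ ⊙ v ≡ v
⊙-identityˡ [] = refl
⊙-identityˡ (x ∷ v) = cong₂ _∷_ (ℚP.*-identityˡ x) (⊙-identityˡ v)

⊙-distribʳ-+ : ∀ {d} (v : Point d) x y → (x + y) ⊙ v ≡ (x ⊙ v) ⊕ (y ⊙ v)
⊙-distribʳ-+ [] x y = refl
⊙-distribʳ-+ (z ∷ v) x y = cong₂ _∷_ (ℚP.*-distribʳ-+ z x y) (⊙-distribʳ-+ v x y)

⊕-identityˡ : ∀ {d} (v : Point d) → replicate d 0ℚ ⊕ v ≡ v
⊕-identityˡ [] = refl
⊕-identityˡ (x ∷ v) = cong₂ _∷_ (ℚP.+-identityˡ x) (⊕-identityˡ v)

⊕-identityʳ : ∀ {d} (v : Point d) → v ⊕ replicate d 0ℚ ≡ v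
⊕-identityʳ [] = refl
⊕-identityʳ (x ∷ v) = cong₂ _∷_ (ℚP.+-identityʳ x) (⊕-identityʳ v)

sumℚ-replicate-0 : ∀ k → sumℚ (replicate k 0ℚ) ≡ 0ℚ
sumℚ-replicate-0 zero = refl
sumℚ-replicate-0 (suc k) = trans (ℚP.+-identityˡ _) (sumℚ-replicate-0 k)

linComb-replicate-0 : ∀ {d} (S : List (Point d)) →
  linComb (replicate (length S) 0ℚ) (fromList S) ≡ replicate d 0ℚ
linComb-replicate-0 [] = refl
linComb-replicate-0 (s ∷ S) =
  trans (cong₂ _⊕_ (⊙-zeroˡ s) (linComb-replicate-0 S)) (⊕-identityˡ _)

∈⇒InConv : ∀ {d} (S : List (Point d)) {x} → x ∈ S → InConv S x
∈⇒InConv (s ∷ S) (here refl) = 1ℚ ∷ replicate (length S) 0ℚ , nonNeg , sum≡1 , sym s≡lc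
  where
  nonNeg : (j : Fin (suc (length S))) → 0ℚ ≤ lookup (1ℚ ∷ replicate (length S) 0ℚ) j
  nonNeg zero = ℚP.<⇒≤ (ℚP.positive⁻¹ 1ℚ)
  nonNeg (suc j) = ℚP.≤-reflexive (sym (VecP.lookup-replicate j 0ℚ))
  sum≡1 = trans (cong (1ℚ +_) (sumℚ-replicate-0 (length S))) (ℚP.+-identityʳ 1ℚ)
  s≡lc = trans (cong₂ _⊕_ (⊙-identityˡ s) (linComb-replicate-0 S)) (⊕-identityʳ s)
∈⇒InConv (s ∷ S) (there x∈S) with ∈⇒InConv S x∈S
... | w , nonNeg , sum≡1 , x≡lc =
  0ℚ ∷ w , nonNeg′ , trans (ℚP.+-identityˡ _) sum≡1 ,
  trans x≡lc (sym (trans (cong (_⊕ _) (⊙-zeroˡ s)) (⊕-identityˡ _)))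
  where
  nonNeg′ : (j : Fin (suc (length S))) → 0ℚ ≤ lookup (0ℚ ∷ w) j
  nonNeg′ zero = ℚP.≤-refl
  nonNeg′ (suc j) = nonNeg j

module _ {d} (n p : Point d) where

  -- For a convex combination of points each equal to p or strictly below p in direction n,
  -- Below 1 says that the combination is p itself or strictly below p.
  Below : ℚ → Point d → Set
  Below w x = x ≡ w ⊙ p ⊎ n · x < w * (n · p)

  Below⇒≤ : ∀ w {x} → Below w x → n · x ≤ w * (n · p)
  Below⇒≤ w (inj₁ refl) = ℚP.≤-reflexive (·-⊙ʳ w n p)
  Below⇒≤ w (inj₂ lt) = ℚP.<⇒≤ lt

  Below-⊙ : ∀ w {x} → 0ℚ ≤ w → x ≡ p ⊎ n · x < n · p → Below w (w ⊙ x)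
  Below-⊙ w _ (inj₁ refl) = inj₁ refl
  Below-⊙ w {x} 0≤w (inj₂ lt) with ℚP.<-cmp 0ℚ w
  ... | tri< 0<w _ _ = inj₂ (begin-strict
    n · (w ⊙ x)  ≡⟨ ·-⊙ʳ w n x ⟩
    w * (n · x)  <⟨ ℚP.*-monoʳ-<-pos w {{ℚ.positive 0<w}} lt ⟩
    w * (n · p)  ∎)
    where open ℚP.≤-Reasoning
  ... | tri≈ _ refl _ = inj₁ (trans (⊙-zeroˡ x) (sym (⊙-zeroˡ p)))
  ... | tri> _ _ w<0 = contradiction 0≤w (<⇒≱ w<0)

  Below-⊕ : ∀ v w {x y} → Below v x → Below w y → Below (v + w) (x ⊕ y)
  Below-⊕ v w (inj₁ refl) (inj₁ refl) = inj₁ (sym (⊙-distribʳ-+ p v w))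
  Below-⊕ v w {x} {y} bx (inj₂ lt) = inj₂ (begin-strict
    n · (x ⊕ y)                ≡⟨ ·-distribˡ-⊕ n x y ⟩
    n · x + n · y              <⟨ ℚP.+-mono-≤-< (Below⇒≤ v bx) lt ⟩
    v * (n · p) + w * (n · p)  ≡⟨ ℚP.*-distribʳ-+ (n · p) v w ⟨
    (v + w) * (n · p)          ∎)
    where open ℚP.≤-Reasoning
  Below-⊕ v w {x} {y} (inj₂ lt) by = inj₂ (begin-strict
    n · (x ⊕ y)                ≡⟨ ·-distribˡ-⊕ n x y ⟩
    n · x + n · y              <⟨ ℚP.+-mono-<-≤ lt (Below⇒≤ w by) ⟩
    v * (n · p) + w * (n · p)  ≡⟨ ℚP.*-distribʳ-+ (n · p) v w ⟨
    (v + w) * (n · p)          ∎)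
    where open ℚP.≤-Reasoning

  Below-linComb : (S : List (Point d)) → (∀ {x} → x ∈ S → x ≡ p ⊎ n · x < n · p) →
                  (w : Vec ℚ (length S)) → (∀ j → 0ℚ ≤ lookup w j) →
                  Below (sumℚ w) (linComb w (fromList S))
  Below-linComb [] _ [] _ = inj₁ (sym (⊙-zeroˡ p))
  Below-linComb (s ∷ S) atMost (w₀ ∷ w) w≥0 =
    Below-⊕ w₀ (sumℚ w) (Below-⊙ w₀ (w≥0 zero) (atMost (here refl)))
            (Below-linComb S (λ x∈S → atMost (there x∈S)) w (λ j → w≥0 (suc j)))

strictMax⇒IsVertexWrt : ∀ {d} (n p : Point d) (S : List (Point d)) →
                        (∀ {x} → x ∈ S → x ≢ p → n · x < n · p) → IsVertexWrt n S p
strictMax⇒IsVertexWrt n p S strict q (w , w≥0 , sum≡1 , refl) q≢p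
  with Below-linComb n p S atMost w w≥0
  where
  atMost : ∀ {x} → x ∈ S → x ≡ p ⊎ n · x < n · p
  atMost {x} x∈S with VecP.≡-dec ℚP._≟_ x p
  ... | yes x≡p = inj₁ x≡p
  ... | no x≢p = inj₂ (strict x∈S x≢p)
... | inj₁ q≡p = contradiction (trans q≡p (trans (cong (_⊙ p) sum≡1) (⊙-identityˡ p))) q≢p
... | inj₂ q<p = subst (n · q <_) (trans (cong (_* (n · p)) sum≡1) (ℚP.*-identityˡ (n · p))) q<p

∃-bound-between : ∀ {M} (xs : List ℚ) → All (_< M) xs → ∃ λ r → All (_< r) xs × r < M
∃-bound-between {M} xs xs<M =
  let r , m<r , r<M = ℚP.<-dense m<M
  in r , All.map (λ x≤m → ℚP.≤-<-trans x≤m m<r) (xs≤max (M - 1ℚ) xs) , r<M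
  where
  m<M : max (M - 1ℚ) xs < M
  m<M = argmax-all id (p-1<p M) xs<M

ι : ℕ → ℚ
ι k = ℤ.+ k / 1

ι≡mkℚ : ∀ k → ι k ≡ mkℚ (ℤ.+ k) 0 (Coprimality.sym (Coprimality.1-coprimeTo k))
ι≡mkℚ k = ℚP.normalize-coprime (Coprimality.sym (Coprimality.1-coprimeTo k))

ι-injective : ∀ {a b} → ι a ≡ ι b → a ≡ b
ι-injective {a} {b} eq = cong ℤ.∣_∣ (begin
  ℤ.+ a     ≡⟨ cong ↥_ (ι≡mkℚ a) ⟨
  ↥ (ι a)   ≡⟨ cong ↥_ eq ⟩
  ↥ (ι b)   ≡⟨ cong ↥_ (ι≡mkℚ b) ⟩
  ℤ.+ b     ∎)
  where open ≡-Reasoning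

embed-injective : ∀ {d} {s t : Exponent d} → embed s ≡ embed t → s ≡ t
embed-injective {s = []} {[]} _ = refl
embed-injective {s = x ∷ s} {y ∷ t} eq =
  cong₂ _∷_ (ι-injective (VecP.∷-injectiveˡ eq)) (embed-injective (VecP.∷-injectiveʳ eq))

ι-+ : ∀ a b → ι a + ι b ≡ ι (a ℕ.+ b)
ι-+ a b = trans (cong₂ _+_ (ι≡mkℚ a) (ι≡mkℚ b))
  (cong (_/ 1) (cong₂ ℤ._+_ (ℤP.*-identityʳ (ℤ.+ a)) (ℤP.*-identityʳ (ℤ.+ b))))

ι-* : ∀ a b → ι a * ι b ≡ ι (a ℕ.* b)
ι-* a b = trans (cong₂ _*_ (ι≡mkℚ a) (ι≡mkℚ b)) (cong (_/ 1) (sym (ℤP.pos-* a b)))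

unique-keys⇒functional : ∀ {A B : Set} {xs : List (A × B)} {k a b} → Unique (map proj₁ xs) →
                         (k , a) ∈ xs → (k , b) ∈ xs → a ≡ b
unique-keys⇒functional _ (here refl) (here refl) = refl
unique-keys⇒functional (k∉ ∷ _) (here refl) (there kb∈) = ⊥-elim (All.lookup k∉ (∈-map⁺ proj₁ kb∈) refl)
unique-keys⇒functional (k∉ ∷ _) (there ka∈) (here refl) = ⊥-elim (All.lookup k∉ (∈-map⁺ proj₁ ka∈) refl)
unique-keys⇒functional (_ ∷ u) (there ka∈) (there kb∈) = unique-keys⇒functional u ka∈ kb∈

frame⁻-below-vertex : ∀ {d} (n : Point d) (f : Poly d) {p q} → p ∈frame⁺ f →
                      IsVertexWrt n (map embed (frame f)) (embed p) →
                      q ∈frame⁻ f → n · embed q < n · embed p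
frame⁻-below-vertex n f {p} {q} (a , pa∈ , 0<a) vertex (b , qb∈ , b<0) =
  vertex (embed q) (∈⇒InConv _ (∈-map⁺ embed (∈-map⁺ proj₁ qb∈))) q≢p
  where
  q≢p : embed q ≢ embed p
  q≢p eq with embed-injective eq
  ... | refl = ℤP.<-asym 0<a (subst (ℤ._< ℤ.+ 0) (unique-keys⇒functional (distinct f) qb∈ pa∈) b<0)

vertex⇒ψ : ∀ {d} (n : Point d) (f : Poly d) {p} → p ∈frame⁺ f →
           IsVertexWrt n (map embed (frame f)) (embed p) → ∃ λ c → ψ f n c
vertex⇒ψ n f {p} p∈⁺ vertex =
  let r , values<r , r<M = ∃-bound-between (map value negativeTerms) values<M
  in - r , (p , p∈⁺ , p<q⇒0<q-p r<M) , λ where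
       q (b , qb∈ , b<0) → p<q⇒p-q<0 (All.lookup values<r (∈-map⁺ value (∈-filter⁺ negative? qb∈ b<0)))
  where
  negative? = λ (t : Exponent _ × ℤ) → proj₂ t ℤP.<? ℤ.+ 0
  negativeTerms = List.filter negative? (terms f)
  value : Exponent _ × ℤ → ℚ
  value t = n · embed (proj₁ t)
  values<M : All (_< n · embed p) (map value negativeTerms)
  values<M = All.tabulate λ v∈ → case ∈-map⁻ value v∈ of λ where
    (t , t∈ , refl) → frame⁻-below-vertex n f p∈⁺ vertex (proj₂ t , ∈-filter⁻ negative? t∈)

Tolerates : ℚ → ℚ × ℚ → Set
Tolerates ε (a , b) = 0ℚ < b → ε * a < b

∃-tolerated : ∀ ab → ∃ λ ε → 0ℚ < ε × Tolerates ε ab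
∃-tolerated (a , b) with 0ℚ ℚP.<? b | a ℚP.≤? 0ℚ
... | no 0≮b | _ = 1ℚ , ℚP.positive⁻¹ 1ℚ , λ 0<b → contradiction 0<b 0≮b
... | yes 0<b | yes a≤0 =
  1ℚ , ℚP.positive⁻¹ 1ℚ , λ _ → ℚP.≤-<-trans (ℚP.≤-trans (ℚP.≤-reflexive (ℚP.*-identityˡ a)) a≤0) 0<b
... | yes 0<b | no a≰0 =
  let ε , 0<ε , ε<b/a = ℚP.<-dense 0<b/a
  in ε , 0<ε , λ _ → below-b/a⇒tolerated ε<b/a
  where
  instance
    a-pos = ℚ.positive (ℚP.≰⇒> a≰0)
    a-nonZero = ℚP.pos⇒nonZero a
    b-pos = ℚ.positive 0<b
    1/a-pos = ℚP.1/pos⇒pos a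
  0<b/a : 0ℚ < b * 1/ a
  0<b/a = ℚP.positive⁻¹ _ {{ℚP.pos*pos⇒pos b (1/ a)}}
  below-b/a⇒tolerated : ∀ {ε} → ε < b * 1/ a → ε * a < b
  below-b/a⇒tolerated {ε} ε<b/a = begin-strict
    ε * a            <⟨ ℚP.*-monoˡ-<-pos a ε<b/a ⟩
    b * 1/ a * a     ≡⟨ ℚP.*-assoc b (1/ a) a ⟩
    b * (1/ a * a)   ≡⟨ cong (b *_) (ℚP.*-inverseˡ a) ⟩
    b * 1ℚ           ≡⟨ ℚP.*-identityʳ b ⟩
    b                ∎
    where open ℚP.≤-Reasoning

Tolerates-anti : ∀ {ε ε′} ab → 0ℚ ≤ ε′ → ε′ ≤ ε → Tolerates ε ab → Tolerates ε′ ab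
Tolerates-anti {ε} {ε′} (a , b) 0≤ε′ ε′≤ε tolerates 0<b with 0ℚ ℚP.≤? a
... | yes 0≤a = ℚP.≤-<-trans (ℚP.*-monoʳ-≤-nonNeg a {{ℚ.nonNegative 0≤a}} ε′≤ε) (tolerates 0<b)
... | no 0≰a = ℚP.≤-<-trans ε′a≤0 0<b
  where
  ε′a≤0 : ε′ * a ≤ 0ℚ
  ε′a≤0 = ℚP.≤-trans (ℚP.*-monoˡ-≤-nonNeg ε′ {{ℚ.nonNegative 0≤ε′}} (ℚP.<⇒≤ (ℚP.≰⇒> 0≰a)))
                     (ℚP.≤-reflexive (ℚP.*-zeroʳ ε′))

∃-tolerated-by-all : (L : List (ℚ × ℚ)) → ∃ λ ε → 0ℚ < ε × All (Tolerates ε) L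
∃-tolerated-by-all [] = 1ℚ , ℚP.positive⁻¹ 1ℚ , All.[]
∃-tolerated-by-all (ab ∷ L) with ∃-tolerated ab | ∃-tolerated-by-all L
... | ε₁ , 0<ε₁ , tolerates₁ | ε , 0<ε , tolerates =
  ε₁ ⊓ ε , 0<ε₁⊓ε ,
  Tolerates-anti ab 0≤ε₁⊓ε (ℚP.p⊓q≤p ε₁ ε) tolerates₁ All.∷
  All.map (Tolerates-anti _ 0≤ε₁⊓ε (ℚP.p⊓q≤q ε₁ ε)) tolerates
  where
  0<ε₁⊓ε : 0ℚ < ε₁ ⊓ ε
  0<ε₁⊓ε with ℚP.⊓-sel ε₁ ε
  ... | inj₁ ≡ε₁ = subst (0ℚ <_) (sym ≡ε₁) 0<ε₁
  ... | inj₂ ≡ε = subst (0ℚ <_) (sym ≡ε) 0<ε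
  0≤ε₁⊓ε = ℚP.<⇒≤ 0<ε₁⊓ε

∃-order-preserving-perturbation :
  ∀ {A : Set} (g h : A → ℚ) (U : List A) → ∃ λ ε → 0ℚ < ε ×
    (∀ {s t} → s ∈ U → t ∈ U → g s < g t → g s + ε * h s < g t + ε * h t)
∃-order-preserving-perturbation g h U
  with ∃-tolerated-by-all (List.cartesianProductWith (λ s t → h s - h t , g t - g s) U U)
... | ε , 0<ε , tolerates = ε , 0<ε , λ {s} {t} s∈ t∈ gs<gt → begin-strict
  g s + ε * h s
    ≡⟨ solve 4 (λ gs hs ht ε → gs :+ ε :* hs := (gs :+ ε :* ht) :+ ε :* (hs :- ht)) refl (g s) (h s) (h t) ε ⟩
  (g s + ε * h t) + ε * (h s - h t)
    <⟨ ℚP.+-monoʳ-< (g s + ε * h t)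
         (All.lookup tolerates (∈-cartesianProductWith⁺ _ s∈ t∈) (p<q⇒0<q-p gs<gt)) ⟩
  (g s + ε * h t) + (g t - g s)
    ≡⟨ solve 3 (λ gs gt εht → (gs :+ εht) :+ (gt :- gs) := gt :+ εht) refl (g s) (g t) (ε * h t) ⟩
  g t + ε * h t
    ∎
  where
  open ℚP.≤-Reasoning

fromDigits : ℕ → ∀ {d} → Exponent d → ℕ
fromDigits B [] = 0
fromDigits B (x ∷ s) = x ℕ.+ fromDigits B s ℕ.* B

fromDigits-injective : ∀ B .{{_ : ℕ.NonZero B}} {d} {s t : Exponent d} →
                       VecAll (ℕ._< B) s → VecAll (ℕ._< B) t →
                       fromDigits B s ≡ fromDigits B t → s ≡ t
fromDigits-injective B [] [] _ = refl
fromDigits-injective B {s = x ∷ s} {y ∷ t} (x<B ∷ s<B) (y<B ∷ t<B) eq =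
  cong₂ _∷_ x≡y (fromDigits-injective B s<B t<B
    (ℕP.*-cancelʳ-≡ _ _ B (ℕP.+-cancelˡ-≡ x _ _ (trans eq (cong (ℕ._+ fromDigits B t ℕ.* B) (sym x≡y))))))
  where
  x≡y : x ≡ y
  x≡y = begin
    x                              ≡⟨ m<n⇒m%n≡m x<B ⟨
    x % B                          ≡⟨ [m+kn]%n≡m%n x (fromDigits B s) B ⟨
    (x ℕ.+ fromDigits B s ℕ.* B) % B ≡⟨ cong (_% B) eq ⟩
    (y ℕ.+ fromDigits B t ℕ.* B) % B ≡⟨ [m+kn]%n≡m%n y (fromDigits B t) B ⟩
    y % B                          ≡⟨ m<n⇒m%n≡m y<B ⟩
    y                              ∎
    where open ≡-Reasoning

powers : ℕ → ∀ d → Point d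
powers B zero = []
powers B (suc d) = 1ℚ ∷ (ι B ⊙ powers B d)

powers-· : ∀ B {d} (s : Exponent d) → powers B d · embed s ≡ ι (fromDigits B s)
powers-· B [] = refl
powers-· B (x ∷ s) = begin
  1ℚ * ι x + (ι B ⊙ powers B _) · embed s  ≡⟨ cong₂ _+_ (ℚP.*-identityˡ (ι x)) (·-⊙ˡ (ι B) (powers B _) (embed s)) ⟩
  ι x + ι B * (powers B _ · embed s)       ≡⟨ cong (λ z → ι x + ι B * z) (powers-· B s) ⟩
  ι x + ι B * ι (fromDigits B s)          ≡⟨ cong (ι x +_) (trans (ℚP.*-comm (ι B) _) (ι-* (fromDigits B s) B)) ⟩
  ι x + ι (fromDigits B s ℕ.* B)          ≡⟨ ι-+ x _ ⟩
  ι (x ℕ.+ fromDigits B s ℕ.* B)          ∎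
  where open ≡-Reasoning

coordinates≤sum : ∀ {d} (s : Exponent d) → VecAll (ℕ._≤ Vec.sum s) s
coordinates≤sum [] = []
coordinates≤sum (x ∷ s) =
  ℕP.m≤m+n x _ ∷ VecAll.map (λ y≤ → ℕP.≤-trans y≤ (ℕP.m≤n+m _ x)) (coordinates≤sum s)

coordinateBound : ∀ {d} → List (Exponent d) → ℕ
coordinateBound U = sum (map Vec.sum U)

coordinates≤coordinateBound : ∀ {d} {U : List (Exponent d)} {s} → s ∈ U → VecAll (ℕ._≤ coordinateBound U) s
coordinates≤coordinateBound {U = s ∷ U} (here refl) =
  VecAll.map (λ x≤ → ℕP.≤-trans x≤ (ℕP.m≤m+n _ _)) (coordinates≤sum s)
coordinates≤coordinateBound {U = t ∷ U} (there s∈) =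
  VecAll.map (λ x≤ → ℕP.≤-trans x≤ (ℕP.m≤n+m _ (Vec.sum t))) (coordinates≤coordinateBound s∈)

module _ {d} (U : List (Exponent d)) where

  Refines : Point d → Point d → Set
  Refines n n′ = ∀ {s t} → s ∈ U → t ∈ U → n · embed s < n · embed t → n′ · embed s < n′ · embed t

  Separates : Point d → Set
  Separates n = ∀ {s t} → s ∈ U → t ∈ U → n · embed s ≡ n · embed t → s ≡ t

  separatingDirection : Point d
  separatingDirection = powers (suc (coordinateBound U)) d

  separatingDirection-separates : Separates separatingDirection
  separatingDirection-separates {s} {t} s∈ t∈ eq =
    fromDigits-injective B (digits s∈) (digits t∈)
      (ι-injective (trans (sym (powers-· B s)) (trans eq (powers-· B t))))
    where
    B = suc (coordinateBound U)
    digits : ∀ {s} → s ∈ U → VecAll (ℕ._< B) s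
    digits s∈ = VecAll.map ℕ.s≤s (coordinates≤coordinateBound s∈)

·-perturbation : ∀ {d} (n e : Point d) ε x → (n ⊕ (ε ⊙ e)) · x ≡ n · x + ε * (e · x)
·-perturbation n e ε x = trans (·-distribʳ-⊕ n (ε ⊙ e) x) (cong (n · x +_) (·-⊙ˡ ε e x))

module _ {d} (U : List (Exponent d)) (n e : Point d) {ε} (0<ε : 0ℚ < ε) where

  private
    n′ = n ⊕ (ε ⊙ e)

  perturbation-refines : (∀ {s t} → s ∈ U → t ∈ U → n · embed s < n · embed t →
                           n · embed s + ε * (e · embed s) < n · embed t + ε * (e · embed t)) →
                         Refines U n n′
  perturbation-refines preserves s∈ t∈ ns<nt =
    subst₂ _<_ (sym (·-perturbation n e ε _)) (sym (·-perturbation n e ε _)) (preserves s∈ t∈ ns<nt)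

  perturbation-breaks-ties : ∀ {s t} → n · embed s ≡ n · embed t → e · embed s < e · embed t →
                             n′ · embed s < n′ · embed t
  perturbation-breaks-ties {s} {t} ns≡nt es<et = begin-strict
    n′ · embed s                      ≡⟨ ·-perturbation n e ε _ ⟩
    n · embed s + ε * (e · embed s)   <⟨ ℚP.+-mono-≤-< (ℚP.≤-reflexive ns≡nt)
                                           (ℚP.*-monoʳ-<-pos ε {{ℚ.positive 0<ε}} es<et) ⟩
    n · embed t + ε * (e · embed t)   ≡⟨ ·-perturbation n e ε _ ⟨
    n′ · embed t                      ∎
    where open ℚP.≤-Reasoning

  perturbation-separates : Refines U n n′ → Separates U e → Separates U n′
  perturbation-separates refines e-separates {s} {t} s∈ t∈ eq
    with ℚP.<-cmp (n · embed s) (n · embed t) | ℚP.<-cmp (e · embed s) (e · embed t)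
  ... | tri< ns<nt _ _ | _ = contradiction eq (ℚP.<⇒≢ (refines s∈ t∈ ns<nt))
  ... | tri> _ _ ns>nt | _ = contradiction (sym eq) (ℚP.<⇒≢ (refines t∈ s∈ ns>nt))
  ... | tri≈ _ ns≡nt _ | tri< es<et _ _ = contradiction eq (ℚP.<⇒≢ (perturbation-breaks-ties ns≡nt es<et))
  ... | tri≈ _ _ _ | tri≈ _ es≡et _ = e-separates s∈ t∈ es≡et
  ... | tri≈ _ ns≡nt _ | tri> _ _ es>et =
    contradiction (sym eq) (ℚP.<⇒≢ (perturbation-breaks-ties (sym ns≡nt) es>et))

∃-separating-refinement : ∀ {d} (U : List (Exponent d)) (n : Point d) →
                          ∃ λ n′ → Refines U n n′ × Separates U n′
∃-separating-refinement U n =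
  let ε , 0<ε , preserves = ∃-order-preserving-perturbation (n ·_ ∘ embed) (e ·_ ∘ embed) U
      refines = perturbation-refines U n e 0<ε preserves
  in n ⊕ (ε ⊙ e) , refines , perturbation-separates U n e 0<ε refines (separatingDirection-separates U)
  where
  e = separatingDirection U

∈frame⇒∈frame⁺⊎∈frame⁻ : ∀ {d} (f : Poly d) {p} → p ∈ frame f → p ∈frame⁺ f ⊎ p ∈frame⁻ f
∈frame⇒∈frame⁺⊎∈frame⁻ f p∈ with ∈-map⁻ proj₁ p∈
... | (_ , b) , pb∈ , refl with ℤP.<-cmp (ℤ.+ 0) b
... | tri< 0<b _ _ = inj₁ (b , pb∈ , 0<b)
... | tri≈ _ 0≡b _ = contradiction (sym 0≡b) (All.lookup (nonzero f) pb∈)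
... | tri> _ _ b<0 = inj₂ (b , pb∈ , b<0)

separatedMax⇒strictMax : ∀ {d} (n : Point d) {S : List (Exponent d)} {p} → p ∈ S →
                         (∀ {s} → s ∈ S → n · embed s ≤ n · embed p) → Separates S n →
                         ∀ {x} → x ∈ map embed S → x ≢ embed p → n · x < n · embed p
separatedMax⇒strictMax n {p = p} p∈ maximal separates x∈ x≢p with ∈-map⁻ embed x∈
... | s , s∈ , refl with ℚP.<-cmp (n · embed s) (n · embed p)
... | tri< ns<np _ _ = ns<np
... | tri≈ _ ns≡np _ = contradiction (cong embed (separates s∈ p∈ ns≡np)) x≢p
... | tri> _ _ ns>np = contradiction (maximal s∈) (<⇒≱ ns>np)

ψ⇒positiveVertex : ∀ {d} (U : List (Exponent d)) (n n′ : Point d) (f : Poly d) (c : ℚ) →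
                   frame f ⊆ U → Refines U n n′ → Separates U n′ → ψ f n c →
                   ∃ λ p → p ∈frame⁺ f × IsVertexWrt n′ (map embed (frame f)) (embed p)
ψ⇒positiveVertex U n n′ f c f⊆U refines separates ((p⁺ , (_ , p⁺∈terms , _) , 0<p⁺+c) , negative) =
  p , positive ,
  strictMax⇒IsVertexWrt n′ (embed p) _
    (separatedMax⇒strictMax n′ p∈ maximal (λ s∈ t∈ → separates (f⊆U s∈) (f⊆U t∈)))
  where
  value : Exponent _ → ℚ
  value s = n′ · embed s
  p = argmax value p⁺ (frame f)
  p⁺∈ : p⁺ ∈ frame f
  p⁺∈ = ∈-map⁺ proj₁ p⁺∈terms
  p∈ : p ∈ frame f
  p∈ = argmax-all value p⁺∈ (All.tabulate id)
  maximal : ∀ {s} → s ∈ frame f → value s ≤ value p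
  maximal = All.lookup (f[xs]≤f[argmax] p⁺ (frame f))
  not-negative : ¬ p ∈frame⁻ f
  not-negative p∈⁻ = <⇒≱ (refines (f⊆U p∈) (f⊆U p⁺∈) np<np⁺) (maximal p⁺∈)
    where
    np<np⁺ : n · embed p < n · embed p⁺
    np<np⁺ = +-cancelʳ-< c (ℚP.<-trans (negative p p∈⁻) 0<p⁺+c)
  positive : p ∈frame⁺ f
  positive = [ id , ⊥-elim ∘ not-negative ]′ (∈frame⇒∈frame⁺⊎∈frame⁻ f p∈)

allFrames : ∀ {d m} → (Fin m → Poly d) → List (Exponent d)
allFrames {m = m} fs = concatMap (frame ∘ fs) (allFin m)

frame⊆allFrames : ∀ {d m} (fs : Fin m → Poly d) i → frame (fs i) ⊆ allFrames fs
frame⊆allFrames fs i s∈ = ∈-concatMap⁺ (frame ∘ fs) (lose (∈-allFin i) s∈)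

cluster⇒ψ : ∀ {d m} (fs : Fin m → Poly d) (n : Point d) → HasPositiveVertexCluster fs n →
            Σ (Fin m → ℚ) λ c → ∀ i → ψ (fs i) n (c i)
cluster⇒ψ fs n (ps , cluster) = proj₁ ∘ ψᵢ , proj₂ ∘ ψᵢ
  where
  ψᵢ : ∀ i → ∃ λ c → ψ (fs i) n c
  ψᵢ i = vertex⇒ψ n (fs i) (proj₁ (cluster i)) (proj₂ (cluster i))

ψ⇒cluster : ∀ {d m} (fs : Fin m → Poly d) (n : Point d) (c : Fin m → ℚ) → (∀ i → ψ (fs i) n (c i)) →
            ∃ λ n′ → HasPositiveVertexCluster fs n′
ψ⇒cluster fs n c ψs =
  let n′ , refines , separates = ∃-separating-refinement (allFrames fs) n
      vertexᵢ = λ i → ψ⇒positiveVertex (allFrames fs) n n′ (fs i) (c i) (frame⊆allFrames fs i)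
                                       refines separates (ψs i)
  in n′ , proj₁ ∘ vertexᵢ , proj₂ ∘ vertexᵢ

theorem2 : ∀ {d m : ℕ} (fs : Fin m → Poly d) →
    (∃ λ (n : Point d) → HasPositiveVertexCluster fs n) ⇔
    (∃ λ (n : Point d) → Σ (Fin m → ℚ) λ c → ∀ i → ψ (fs i) n (c i))
theorem2 fs = mk⇔ (λ (n , cluster) → n , cluster⇒ψ fs n cluster)
                  (λ (n , c , ψs) → ψ⇒cluster fs n c ψs)
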